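{- Let $A=(Ctrl,Sto,\mathit{init},\mathit{fin},\to)$ and $A'=(Ctrl',Sto',\mathit{init}',\mathit{fin}',\to')$ be automata, $L,R,J$ live alignment conditions, $K$ a keep set, and $\mathcal{Q},\mathcal{S}\subseteq Sto\times Sto'$. Suppose $\prod(A,A',L,R,J,K)$ is $\mathcal{Q}$-adequate in the $\forall\exists$ sense and $an$ is an annotation of $\prod(A,A',L,R,J,K)$ for $\{\mathcal{Q}\}\{\mathcal{S}\}$. If $an$ is valid then $A,A'\models\langle\mathcal{Q}\leadsto\mathcal{S}\rangle$.
   Context: An automaton is $(Ctrl,Sto,\mathit{init},\mathit{fin},\to)$ with $Sto$ a set, $Ctrl$ a finite set containing distinct $\mathit{init},\mathit{fin}$, and $\to\ \subseteq(Ctrl\times Sto)^2$ such that $(n,s)\to(m,t)$ implies $n\neq\mathit{fin}$ and $n\neq m$. $A,A'\models\langle\mathcal{Q}\leadsto\mathcal{S}\rangle$ means: for all $(s,s')\in\mathcal{Q}$ and $t$ with $(\mathit{init},s)\to^*(\mathit{fin},t)$ there is $t'$ with $(\mathit{init}',s')\to'^*(\mathit{fin}',t')$ and $(t,t')\in\mathcal{S}$. $L,R,J\subseteq(Ctrl\times Ctrl')\times(Sto\times Sto')$ are live if states in $L$ have a left successor, in $R$ a right successor, in $J$ both. Unfiltered product transitions $((n,n'),(s,s'))\Rightarrow((m,m'),(t,t'))$: (LO) source in $L$, $(n,s)\to(m,t)$, $(n',s')=(m',t')$; (RO) source in $R$, $(n,s)=(m,t)$, $(n',s')\to'(m',t')$;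 (JO) source in $J$, both sides step. For $K\subseteq(Ctrl\times Ctrl')\times(Sto\times Sto')$, $\prod(A,A',L,R,J,K)$ is the automaton with control points $Ctrl\times Ctrl'$, stores $Sto\times Sto'$, initial $(\mathit{init},\mathit{init}')$, final $(\mathit{fin},\mathit{fin}')$ and transitions $X\Rightarrow_K Y$ iff $X\Rightarrow Y$ and $Y\in K$. It is $\mathcal{Q}$-adequate in the $\forall\exists$ sense if for all $(s,s')\in\mathcal{Q}$ and $t$ with $(\mathit{init},s)\to^*(\mathit{fin},t)$ there exists $t'$ with $((\mathit{init},\mathit{init}'),(s,s'))\Rightarrow_K^*((\mathit{fin},\mathit{fin}'),(t,t'))$. An annotation of $\prod(A,A',L,R,J,K)$ for $\{\mathcal{Q}\}\{\mathcal{S}\}$ is a map $an$ from $Ctrl\times Ctrl'$ to subsets of $Sto\times Sto'$ with $an(\mathit{init},\mathit{init}')=\mathcal{Q}$, $an(\mathit{fin},\mathit{fin}')=\mathcal{S}$; it is valid if $(s,s')\in an(n,n')$ and $((n,n'),(s,s'))\Rightarrow_K((m,m'),(t,t'))$ imply $(t,t')\in an(m,m')$. -}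

module Defs where

open import Level using (Level; _⊔_; suc)
open import Data.Nat using (ℕ)
open import Data.Fin using (Fin)
open import Data.Product using (Σ; ∃; _×_; _,_; proj₁; proj₂)
open import Data.Sum using (_⊎_)
open import Relation.Nullary using (¬_)
open import Relation.Binary.PropositionalEquality using (_≡_)
open import Relation.Binary.Construct.Closure.ReflexiveTransitive using (Star)
open import Function.Bundles using (_↔_)

record Automaton : Set₁ where
  field
    Ctrl   : Set
    Sto    : Set
    ctrl-finite : Σ ℕ λ k → Ctrl ↔ Fin k
    init   : Ctrl
    fin    : Ctrl
    init≢fin : ¬ (init ≡ fin)
    _⟶_   : Ctrl × Sto → Ctrl × Sto → Set
    step-src≢fin : ∀ {n s m t} → (n , s) ⟶ (m , t) → ¬ (n ≡ fin)
    step-src≢tgt : ∀ {n s m t} → (n , s) ⟶ (m , t) → ¬ (n ≡ m)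

  _⟶*_ : Ctrl × Sto → Ctrl × Sto → Set
  _⟶*_ = Star _⟶_

open Automaton public

StoRel : Automaton → Automaton → Set₁
StoRel A A' = Sto A × Sto A' → Set

PState : Automaton → Automaton → Set
PState A A' = (Ctrl A × Ctrl A') × (Sto A × Sto A')

PSet : Automaton → Automaton → Set₁
PSet A A' = PState A A' → Set

Sat : (A A' : Automaton) → StoRel A A' → StoRel A A' → Set
Sat A A' Q S =
  ∀ s s' t → Q (s , s') → _⟶*_ A (init A , s) (fin A , t) →
  ∃ λ t' → _⟶*_ A' (init A' , s') (fin A' , t') × S (t , t')

LeftLive : (A A' : Automaton) → PSet A A' → Set
LeftLive A A' L = ∀ n n' s s' → L ((n , n') , (s , s')) →
  ∃ λ m → ∃ λ t → _⟶_ A (n , s) (m , t)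

RightLive : (A A' : Automaton) → PSet A A' → Set
RightLive A A' R = ∀ n n' s s' → R ((n , n') , (s , s')) →
  ∃ λ m' → ∃ λ t' → _⟶_ A' (n' , s') (m' , t')

JointLive : (A A' : Automaton) → PSet A A' → Set
JointLive A A' J = ∀ n n' s s' → J ((n , n') , (s , s')) →
  (∃ λ m → ∃ λ t → _⟶_ A (n , s) (m , t)) ×
  (∃ λ m' → ∃ λ t' → _⟶_ A' (n' , s') (m' , t'))

Live : (A A' : Automaton) → (L R J : PSet A A') → Set
Live A A' L R J = LeftLive A A' L × RightLive A A' R × JointLive A A' J

data ProdStep (A A' : Automaton) (L R J : PSet A A') : PState A A' → PState A A' → Set where
  LO : ∀ {n n' s s' m t} → L ((n , n') , (s , s')) → _⟶_ A (n , s) (m , t) →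
       ProdStep A A' L R J ((n , n') , (s , s')) ((m , n') , (t , s'))
  RO : ∀ {n n' s s' m' t'} → R ((n , n') , (s , s')) → _⟶_ A' (n' , s') (m' , t') →
       ProdStep A A' L R J ((n , n') , (s , s')) ((n , m') , (s , t'))
  JO : ∀ {n n' s s' m m' t t'} → J ((n , n') , (s , s')) →
       _⟶_ A (n , s) (m , t) → _⟶_ A' (n' , s') (m' , t') →
       ProdStep A A' L R J ((n , n') , (s , s')) ((m , m') , (t , t'))

KStep : (A A' : Automaton) (L R J K : PSet A A') → PState A A' → PState A A' → Set
KStep A A' L R J K X Y = ProdStep A A' L R J X Y × K Y

KStep* : (A A' : Automaton) (L R J K : PSet A A') → PState A A' → PState A A' → Set
KStep* A A' L R J K = Star (KStep A A' L R J K)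

Adequate : (A A' : Automaton) (L R J K : PSet A A') → StoRel A A' → Set
Adequate A A' L R J K Q =
  ∀ s s' t → Q (s , s') → _⟶*_ A (init A , s) (fin A , t) →
  ∃ λ t' → KStep* A A' L R J K ((init A , init A') , (s , s')) ((fin A , fin A') , (t , t'))

Annotation : (A A' : Automaton) → Set₁
Annotation A A' = Ctrl A × Ctrl A' → Sto A × Sto A' → Set

IsAnnotationFor : (A A' : Automaton) → Annotation A A' → StoRel A A' → StoRel A A' → Set
IsAnnotationFor A A' an Q S =
  (∀ st → (an (init A , init A') st → Q st) × (Q st → an (init A , init A') st)) ×
  (∀ st → (an (fin A , fin A') st → S st) × (S st → an (fin A , fin A') st))

ValidAnnotation : (A A' : Automaton) (L R J K : PSet A A') → Annotation A A' → Set
ValidAnnotation A A' L R J K an =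
  ∀ n n' s s' m m' t t' → an (n , n') (s , s') →
  KStep A A' L R J K ((n , n') , (s , s')) ((m , m') , (t , t')) →
  an (m , m') (t , t')

{-# OPTIONS --safe #-}
-- Adequacy supplies, for every terminating run of A from a Q-related pair, a run of the
-- filtered product ending in (fin, fin'). Its right projection is a run of A' (LO steps
-- leave the right side unchanged), and validity carries the annotation from Q at
-- (init, init') along the product run to S at (fin, fin').
module Submission where

open import Defs
open import Data.Product using (∃; _×_; _,_; proj₁; proj₂)
open import Relation.Binary.Construct.Closure.ReflexiveTransitive using (Star; ε; _◅_)

module _ (A A' : Automaton) (L R J K : PSet A A') where

  rightState : PState A A' → Ctrl A' × Sto A'
  rightState ((_ , n') , (_ , s')) = (n' , s')

  KStep*-right : ∀ {X Y} → KStep* A A' L R J K X Y →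
                 _⟶*_ A' (rightState X) (rightState Y)
  KStep*-right ε                           = ε
  KStep*-right ((LO _ _ , _)      ◅ run)   = KStep*-right run
  KStep*-right ((RO _ step' , _)  ◅ run)   = step' ◅ KStep*-right run
  KStep*-right ((JO _ _ step' , _) ◅ run)  = step' ◅ KStep*-right run

  holds : Annotation A A' → PState A A' → Set
  holds an (nn' , ss') = an nn' ss'

  ValidAnnotation-KStep* : (an : Annotation A A') → ValidAnnotation A A' L R J K an →
                           ∀ {X Y} → KStep* A A' L R J K X Y → holds an X → holds an Y
  ValidAnnotation-KStep* an valid ε h = h
  ValidAnnotation-KStep* an valid
    (_◅_ {i = (n , n') , (s , s')} {j = (m , m') , (t , t')} step run) h =
    ValidAnnotation-KStep* an valid run (valid n n' s s' m m' t t' h step)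

lemma7p5 : (A A' : Automaton) (L R J K : PSet A A') (Q S : StoRel A A')
    (an : Annotation A A') →
    Live A A' L R J →
    Adequate A A' L R J K Q →
    IsAnnotationFor A A' an Q S →
    ValidAnnotation A A' L R J K an →
    Sat A A' Q S
lemma7p5 A A' L R J K Q S an _ adequate (an-init , an-fin) valid s s' t q run
  with adequate s s' t q run
... | t' , prodRun =
  t' , KStep*-right A A' L R J K prodRun ,
  proj₁ (an-fin (t , t'))
    (ValidAnnotation-KStep* A A' L R J K an valid prodRun (proj₂ (an-init (s , s')) q))
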